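{- Let $e_1,e_2,e_3\in\mathbb{Z}$ be distinct and for $n\geq1$ let $E_{n,\mathbf{e}}$ be the elliptic curve $y^2=(x-e_1n)(x-e_2n)(x-e_3n)$. Then there is a constant $c>0$ depending only on $\mathbf{e}=(e_1,e_2,e_3)$ such that for all sufficiently large $N$, $$\#\{n\leq N:\ E^{\ast}_{n,\mathbf{e}}(\mathbb{Z})\neq\emptyset\}\geq c\,N^{1/2}.$$
   Context: $E_{n,\mathbf{e}}(\mathbb{Z})=\{P\in E_{n,\mathbf{e}}(\mathbb{Q}): x(P)\in\mathbb{Z}\}$ and $E^{\ast}_{n,\mathbf{e}}(\mathbb{Z})=\{P\in E_{n,\mathbf{e}}(\mathbb{Z}): y(P)\neq0\}$. -}

module Defs where

open import Data.Nat using (ℕ)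
open import Data.Integer as ℤ using (ℤ; +_)
open import Data.Rational as ℚ using (ℚ; _/_; 0ℚ)
open import Data.Product using (Σ; ∃; _×_)
open import Relation.Binary.PropositionalEquality using (_≡_; _≢_)

ι : ℤ → ℚ
ι k = k / 1

OnCurve : ℤ → ℤ → ℤ → ℕ → ℚ → ℚ → Set
OnCurve e₁ e₂ e₃ n x y =
  y ℚ.* y ≡ (x ℚ.- ι (e₁ ℤ.* + n)) ℚ.* (x ℚ.- ι (e₂ ℤ.* + n)) ℚ.* (x ℚ.- ι (e₃ ℤ.* + n))

-- Elements of E*_{n,e}(ℤ): affine rational points P = (x , y) of E_{n,e}
-- with x(P) ∈ ℤ and y(P) ≠ 0.  (The point at infinity has no x-coordinate.)
EStarℤ : ℤ → ℤ → ℤ → ℕ → Set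
EStarℤ e₁ e₂ e₃ n =
  Σ ℚ λ x → Σ ℚ λ y →
    OnCurve e₁ e₂ e₃ n x y × (∃ λ (k : ℤ) → x ≡ ι k) × y ≢ 0ℚ

{-# OPTIONS --safe #-}
-- For an integer x with P = (x - e₁)(x - e₂)(x - e₃) positive, the twist n = P k² carries the
-- integral point (x n, P² k³): indeed x n - eᵢ n = (x - eᵢ) n, so the right-hand side is
-- P n³ = P⁴ k⁶.  Taking x > eᵢ for all i, the square multiples P k² ≤ N number
-- K = ⌊√(N / P)⌋, and N < P (K + 1)² ≤ 4 P K² ≤ (2P)² K² gives the bound with c = 1 / (2P).
module Submission where

open import Defs
open import Data.Nat using (ℕ; _≤_)
open import Data.Integer as ℤ using (ℤ; +_)
open import Data.Rational as ℚ using (ℚ; _/_; 0ℚ)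
open import Data.Product using (Σ; ∃; _×_)
open import Data.List using (List; length)
open import Data.List.Relation.Unary.All using (All)
open import Data.List.Relation.Unary.Unique.Propositional using (Unique)
open import Relation.Binary.PropositionalEquality using (_≢_)

import Data.Nat as ℕ
open import Data.Nat using (suc; zero; s≤s; z≤n; z<s; _<_; NonZero; >-nonZero⁻¹)
open import Data.Nat.Properties
open import Data.Nat.Coprimality as Coprimality using (1-coprimeTo)
import Data.Nat.Tactic.RingSolver as ℕ-Solver
open import Data.Integer using (+0; +[1+_]; -[1+_])
import Data.Integer.Properties as ℤP
open import Data.Integer.Tactic.RingSolver using (solve-∀)
open import Data.Rational using (mkℚ)
import Data.Rational.Properties as ℚP
import Data.Rational.Unnormalised as ℚᵘ
import Data.Rational.Unnormalised.Properties as ℚᵘP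
open import Data.Product using (_,_)
open import Data.List using (applyUpTo)
open import Data.List.Properties using (length-applyUpTo)
import Data.List.Relation.Unary.All.Properties as AllP
import Data.List.Relation.Unary.Unique.Propositional.Properties as UniqueP
open import Relation.Binary.PropositionalEquality
open import Relation.Nullary using (yes; no; contradiction)

ι≡mkℚ : ∀ k → ι k ≡ mkℚ k 0 (Coprimality.sym (1-coprimeTo ℤ.∣ k ∣))
ι≡mkℚ (+ n)    = ℚP.normalize-coprime (Coprimality.sym (1-coprimeTo n))
ι≡mkℚ -[1+ n ] = cong ℚ.-_ (ℚP.normalize-coprime (Coprimality.sym (1-coprimeTo (suc n))))

ι-neg : ∀ b → ℚ.- ι b ≡ ι (ℤ.- b)
ι-neg +0       = refl
ι-neg +[1+ n ] = refl
ι-neg -[1+ n ] rewrite ι≡mkℚ +[1+ n ] = refl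

ι-injective : ∀ {i j} → ι i ≡ ι j → i ≡ j
ι-injective {i} {j} ιi≡ιj = cong ℚ.numerator (trans (sym (ι≡mkℚ i)) (trans ιi≡ιj (ι≡mkℚ j)))

ι-* : ∀ a b → ι a ℚ.* ι b ≡ ι (a ℤ.* b)
ι-* a b rewrite ι≡mkℚ a | ι≡mkℚ b = refl

ι-+ : ∀ a b → ι a ℚ.+ ι b ≡ ι (a ℤ.+ b)
ι-+ a b rewrite ι≡mkℚ a | ι≡mkℚ b =
  cong₂ (λ m n → (m ℤ.+ n) / 1) (ℤP.*-identityʳ a) (ℤP.*-identityʳ b)

ι-- : ∀ a b → ι a ℚ.- ι b ≡ ι (a ℤ.- b)
ι-- a b rewrite ι-neg b = ι-+ a (ℤ.- b)

onCurve-ι : ∀ e₁ e₂ e₃ n x y →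
            y ℤ.* y ≡ (x ℤ.- e₁ ℤ.* + n) ℤ.* (x ℤ.- e₂ ℤ.* + n) ℤ.* (x ℤ.- e₃ ℤ.* + n) →
            OnCurve e₁ e₂ e₃ n (ι x) (ι y)
onCurve-ι e₁ e₂ e₃ n x y y²≡f = begin
  ι y ℚ.* ι y                     ≡⟨ ι-* y y ⟩
  ι (y ℤ.* y)                     ≡⟨ cong ι y²≡f ⟩
  ι (d₁ ℤ.* d₂ ℤ.* d₃)            ≡⟨ ι-* (d₁ ℤ.* d₂) d₃ ⟨
  ι (d₁ ℤ.* d₂) ℚ.* ι d₃          ≡⟨ cong (ℚ._* ι d₃) (ι-* d₁ d₂) ⟨
  ι d₁ ℚ.* ι d₂ ℚ.* ι d₃          ≡⟨ cong₂ ℚ._*_ (cong₂ ℚ._*_ (ι-- x _) (ι-- x _)) (ι-- x _) ⟨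
  (ι x ℚ.- ι (e₁ ℤ.* + n)) ℚ.* (ι x ℚ.- ι (e₂ ℤ.* + n)) ℚ.* (ι x ℚ.- ι (e₃ ℤ.* + n)) ∎
  where
  open ≡-Reasoning
  d₁ = x ℤ.- e₁ ℤ.* + n
  d₂ = x ℤ.- e₂ ℤ.* + n
  d₃ = x ℤ.- e₃ ℤ.* + n

scaled-point-identity : ∀ (x e₁ e₂ e₃ k : ℤ) →
  let P = (x ℤ.- e₁) ℤ.* (x ℤ.- e₂) ℤ.* (x ℤ.- e₃)
      n = P ℤ.* (k ℤ.* k)
      y = P ℤ.* P ℤ.* (k ℤ.* k ℤ.* k)
  in y ℤ.* y ≡ (x ℤ.* n ℤ.- e₁ ℤ.* n) ℤ.* (x ℤ.* n ℤ.- e₂ ℤ.* n) ℤ.* (x ℤ.* n ℤ.- e₃ ℤ.* n)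
scaled-point-identity x e₁ e₂ e₃ k = begin
  y ℤ.* y                                           ≡⟨ square≡P*n³ P k ⟩
  P ℤ.* (n ℤ.* n ℤ.* n)                             ≡⟨ product-scaling (x ℤ.- e₁) (x ℤ.- e₂) (x ℤ.- e₃) n ⟨
  (x ℤ.- e₁) ℤ.* n ℤ.* ((x ℤ.- e₂) ℤ.* n) ℤ.* ((x ℤ.- e₃) ℤ.* n)
    ≡⟨ cong₂ ℤ._*_ (cong₂ ℤ._*_ (*-distribʳ-- x e₁ n) (*-distribʳ-- x e₂ n)) (*-distribʳ-- x e₃ n) ⟩
  (x ℤ.* n ℤ.- e₁ ℤ.* n) ℤ.* (x ℤ.* n ℤ.- e₂ ℤ.* n) ℤ.* (x ℤ.* n ℤ.- e₃ ℤ.* n) ∎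
  where
  open ≡-Reasoning
  P = (x ℤ.- e₁) ℤ.* (x ℤ.- e₂) ℤ.* (x ℤ.- e₃)
  n = P ℤ.* (k ℤ.* k)
  y = P ℤ.* P ℤ.* (k ℤ.* k ℤ.* k)
  square≡P*n³ : ∀ P k → P ℤ.* P ℤ.* (k ℤ.* k ℤ.* k) ℤ.* (P ℤ.* P ℤ.* (k ℤ.* k ℤ.* k))
              ≡ P ℤ.* (P ℤ.* (k ℤ.* k) ℤ.* (P ℤ.* (k ℤ.* k)) ℤ.* (P ℤ.* (k ℤ.* k)))
  square≡P*n³ = solve-∀
  product-scaling : ∀ a b c n → a ℤ.* n ℤ.* (b ℤ.* n) ℤ.* (c ℤ.* n) ≡ a ℤ.* b ℤ.* c ℤ.* (n ℤ.* n ℤ.* n)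
  product-scaling = solve-∀
  *-distribʳ-- : ∀ x e n → (x ℤ.- e) ℤ.* n ≡ x ℤ.* n ℤ.- e ℤ.* n
  *-distribʳ-- = solve-∀

square-multiple-EStarℤ : ∀ e₁ e₂ e₃ x q →
                         + suc q ≡ (x ℤ.- e₁) ℤ.* (x ℤ.- e₂) ℤ.* (x ℤ.- e₃) →
                         ∀ j → EStarℤ e₁ e₂ e₃ (suc q ℕ.* (suc j ℕ.* suc j))
square-multiple-EStarℤ e₁ e₂ e₃ x q p≡P j =
  ι (x ℤ.* + n) , ι y , onCurve-ι e₁ e₂ e₃ n (x ℤ.* + n) y on-curve , (x ℤ.* + n , refl) , y≢0
  where
  P = (x ℤ.- e₁) ℤ.* (x ℤ.- e₂) ℤ.* (x ℤ.- e₃)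
  k = + suc j
  n = suc q ℕ.* (suc j ℕ.* suc j)
  y = P ℤ.* P ℤ.* (k ℤ.* k ℤ.* k)
  n≡Pk² : + n ≡ P ℤ.* (k ℤ.* k)
  n≡Pk² = trans (ℤP.pos-* (suc q) _) (cong₂ ℤ._*_ p≡P (ℤP.pos-* (suc j) (suc j)))
  cubic : ℤ → ℤ
  cubic m = (x ℤ.* m ℤ.- e₁ ℤ.* m) ℤ.* (x ℤ.* m ℤ.- e₂ ℤ.* m) ℤ.* (x ℤ.* m ℤ.- e₃ ℤ.* m)
  on-curve : y ℤ.* y ≡ cubic (+ n)
  on-curve = subst (λ m → y ℤ.* y ≡ cubic m) (sym n≡Pk²) (scaled-point-identity x e₁ e₂ e₃ k)
  y≢0 : ι y ≢ 0ℚ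
  y≢0 ιy≡0 with trans (cong (λ Q → Q ℤ.* Q ℤ.* (k ℤ.* k ℤ.* k)) p≡P) (ι-injective {j = + 0} ιy≡0)
  ... | ()

∣e∣≤S⇒1+S-e-positive : ∀ e S → ℤ.∣ e ∣ ≤ S → ∃ λ a → + suc S ℤ.- e ≡ + suc a
∣e∣≤S⇒1+S-e-positive (+ m)    S m≤S = S ℕ.∸ m , (begin
  + suc S ℤ.- + m   ≡⟨ ℤP.[+m]-[+n]≡m⊖n (suc S) m ⟩
  suc S ℤ.⊖ m       ≡⟨ ℤP.⊖-≥ (m≤n⇒m≤1+n m≤S) ⟩
  + (suc S ℕ.∸ m)   ≡⟨ cong +_ (+-∸-assoc 1 m≤S) ⟩
  + suc (S ℕ.∸ m)   ∎)
  where open ≡-Reasoning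
∣e∣≤S⇒1+S-e-positive -[1+ m ] S _ = S ℕ.+ suc m , refl

∃-positive-cubic-value : ∀ e₁ e₂ e₃ → ∃ λ x → ∃ λ q → + suc q ≡ (x ℤ.- e₁) ℤ.* (x ℤ.- e₂) ℤ.* (x ℤ.- e₃)
∃-positive-cubic-value e₁ e₂ e₃ =
  let a₁ , x-e₁ = ∣e∣≤S⇒1+S-e-positive e₁ S (≤-trans (m≤m+n _ _) (m≤m+n _ _))
      a₂ , x-e₂ = ∣e∣≤S⇒1+S-e-positive e₂ S (≤-trans (m≤n+m ℤ.∣ e₂ ∣ ℤ.∣ e₁ ∣) (m≤m+n _ _))
      a₃ , x-e₃ = ∣e∣≤S⇒1+S-e-positive e₃ S (m≤n+m _ _)
  in + suc S , ℕ.pred (suc a₁ ℕ.* suc a₂ ℕ.* suc a₃) , (begin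
    + (suc a₁ ℕ.* suc a₂ ℕ.* suc a₃)      ≡⟨ ℤP.pos-* (suc a₁ ℕ.* suc a₂) (suc a₃) ⟩
    + (suc a₁ ℕ.* suc a₂) ℤ.* + suc a₃    ≡⟨ cong (ℤ._* + suc a₃) (ℤP.pos-* (suc a₁) (suc a₂)) ⟩
    + suc a₁ ℤ.* + suc a₂ ℤ.* + suc a₃    ≡⟨ cong₂ ℤ._*_ (cong₂ ℤ._*_ x-e₁ x-e₂) x-e₃ ⟨
    (+ suc S ℤ.- e₁) ℤ.* (+ suc S ℤ.- e₂) ℤ.* (+ suc S ℤ.- e₃) ∎)
  where
  open ≡-Reasoning
  S = ℤ.∣ e₁ ∣ ℕ.+ ℤ.∣ e₂ ∣ ℕ.+ ℤ.∣ e₃ ∣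

1/[1+_] : ℕ → ℚ
1/[1+ d ] = mkℚ (+ 1) d (1-coprimeTo (suc d))

1/[1+d]>0 : ∀ d → 0ℚ ℚ.< 1/[1+ d ]
1/[1+d]>0 d = ℚ.*<* (ℤ.+<+ (s≤s z≤n))

1/[1+d]²*ι-≤ : ∀ d N M → N ≤ suc d ℕ.* suc d ℕ.* M →
               1/[1+ d ] ℚ.* 1/[1+ d ] ℚ.* ι (+ N) ℚ.≤ ι (+ M)
1/[1+d]²*ι-≤ d N M N≤D²M rewrite ι≡mkℚ (+ N) | ι≡mkℚ (+ M) =
  ℚP.toℚᵘ-cancel-≤ (ℚᵘP.≤-respˡ-≃ (ℚᵘP.≃-sym toℚᵘ-lhs) (ℚᵘ.*≤* cross))
  where
  c = 1/[1+ d ]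
  r = mkℚ (+ N) 0 (Coprimality.sym (1-coprimeTo N))
  toℚᵘ-lhs : ℚ.toℚᵘ (c ℚ.* c ℚ.* r) ℚᵘ.≃ ℚ.toℚᵘ c ℚᵘ.* ℚ.toℚᵘ c ℚᵘ.* ℚ.toℚᵘ r
  toℚᵘ-lhs = ℚᵘP.≃-trans (ℚP.toℚᵘ-homo-* (c ℚ.* c) r) (ℚᵘP.*-congʳ (ℚP.toℚᵘ-homo-* c c))
  cross : + 1 ℤ.* + 1 ℤ.* + N ℤ.* + 1 ℤ.≤ + M ℤ.* + (suc d ℕ.* suc d ℕ.* 1)
  cross = subst₂ ℤ._≤_ (sym N≡) (sym D²M≡) (ℤ.+≤+ N≤D²M)
    where
    N≡ : + 1 ℤ.* + 1 ℤ.* + N ℤ.* + 1 ≡ + N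
    N≡ = trans (ℤP.*-identityʳ _) (ℤP.*-identityˡ (+ N))
    D²M≡ : + M ℤ.* + (suc d ℕ.* suc d ℕ.* 1) ≡ + (suc d ℕ.* suc d ℕ.* M)
    D²M≡ = trans (sym (ℤP.pos-* M _))
                 (cong +_ (trans (*-comm M _) (cong (ℕ._* M) (*-identityʳ (suc d ℕ.* suc d)))))

∃-square-bracket : ∀ p .{{_ : NonZero p}} N → ∃ λ K → p ℕ.* (K ℕ.* K) ≤ N × N < p ℕ.* (suc K ℕ.* suc K)
∃-square-bracket p zero = 0 , ≤-reflexive (*-zeroʳ p) , subst (_< p ℕ.* 1) (*-zeroʳ p) (*-monoʳ-< p z<s)
∃-square-bracket p (suc N) with ∃-square-bracket p N
... | K , pK²≤N , N<p[K+1]² with p ℕ.* (suc K ℕ.* suc K) ≤? suc N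
...   | yes p[K+1]²≤N+1 = suc K , p[K+1]²≤N+1 , ≤-<-trans N<p[K+1]² (*-monoʳ-< p (*-mono-< K+1<K+2 K+1<K+2))
  where
  K+1<K+2 : suc K < suc (suc K)
  K+1<K+2 = n<1+n (suc K)
...   | no  p[K+1]²≰N+1 = K , m≤n⇒m≤1+n pK²≤N , ≰⇒> p[K+1]²≰N+1

square-bracket-bound : ∀ p .{{_ : NonZero p}} N K → p ≤ N → N < p ℕ.* (suc K ℕ.* suc K) →
                       N ≤ (p ℕ.+ p) ℕ.* (p ℕ.+ p) ℕ.* (K ℕ.* K)
square-bracket-bound p N zero p≤N N<p*1 = contradiction p≤N (<⇒≱ (subst (N <_) (*-identityʳ p) N<p*1))
square-bracket-bound p N K@(suc _) p≤N N<p[K+1]² = begin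
  N                                     ≤⟨ <⇒≤ N<p[K+1]² ⟩
  p ℕ.* (suc K ℕ.* suc K)               ≤⟨ *-monoʳ-≤ p (*-mono-≤ K+1≤K+K K+1≤K+K) ⟩
  p ℕ.* ((K ℕ.+ K) ℕ.* (K ℕ.+ K))       ≡⟨ rearrange p K ⟩
  (p ℕ.+ p) ℕ.* 2 ℕ.* (K ℕ.* K)         ≤⟨ *-monoˡ-≤ (K ℕ.* K) (*-monoʳ-≤ (p ℕ.+ p) 2≤p+p) ⟩
  (p ℕ.+ p) ℕ.* (p ℕ.+ p) ℕ.* (K ℕ.* K) ∎
  where
  open ≤-Reasoning
  K+1≤K+K : suc K ≤ K ℕ.+ K
  K+1≤K+K = +-monoˡ-≤ K (s≤s z≤n)
  2≤p+p : 2 ≤ p ℕ.+ p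
  2≤p+p = +-mono-≤ (>-nonZero⁻¹ p) (>-nonZero⁻¹ p)
  rearrange : ∀ p K → p ℕ.* ((K ℕ.+ K) ℕ.* (K ℕ.+ K)) ≡ (p ℕ.+ p) ℕ.* 2 ℕ.* (K ℕ.* K)
  rearrange = ℕ-Solver.solve-∀

square-multiples : ℕ → ℕ → List ℕ
square-multiples p K = applyUpTo (λ j → p ℕ.* (suc j ℕ.* suc j)) K

square-multiples-unique : ∀ p .{{_ : NonZero p}} K → Unique (square-multiples p K)
square-multiples-unique p K =
  UniqueP.applyUpTo⁺₁ _ K (λ i<j _ → <⇒≢ (*-monoʳ-< p (*-mono-< (s≤s i<j) (s≤s i<j))))

square-multiples-length-bound : ∀ q N K → suc q ≤ N → N < suc q ℕ.* (suc K ℕ.* suc K) →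
  let c = 1/[1+ q ℕ.+ suc q ]
      L = length (square-multiples (suc q) K)
  in c ℚ.* c ℚ.* ι (+ N) ℚ.≤ ι (+ L) ℚ.* ι (+ L)
square-multiples-length-bound q N K p≤N N<p[K+1]²
  rewrite length-applyUpTo (λ j → suc q ℕ.* (suc j ℕ.* suc j)) K =
  subst (_ ℚ.≤_) (trans (cong ι (ℤP.pos-* K K)) (sym (ι-* (+ K) (+ K))))
        (1/[1+d]²*ι-≤ (q ℕ.+ suc q) N (K ℕ.* K) (square-bracket-bound (suc q) N K p≤N N<p[K+1]²))

square-multiples-on-curve : ∀ e₁ e₂ e₃ x q → + suc q ≡ (x ℤ.- e₁) ℤ.* (x ℤ.- e₂) ℤ.* (x ℤ.- e₃) →
                            ∀ N K → suc q ℕ.* (K ℕ.* K) ≤ N →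
                            All (λ n → (1 ≤ n) × (n ≤ N) × EStarℤ e₁ e₂ e₃ n) (square-multiples (suc q) K)
square-multiples-on-curve e₁ e₂ e₃ x q p≡P N K pK²≤N = AllP.applyUpTo⁺₁ _ K λ {j} j<K →
  s≤s z≤n ,
  ≤-trans (*-monoʳ-≤ (suc q) (*-mono-≤ j<K j<K)) pK²≤N ,
  square-multiple-EStarℤ e₁ e₂ e₃ x q p≡P j

lemma4 : (e₁ e₂ e₃ : ℤ) → e₁ ≢ e₂ → e₁ ≢ e₃ → e₂ ≢ e₃ →
         Σ ℚ λ c → (0ℚ ℚ.< c) × (∃ λ (N₀ : ℕ) → (N : ℕ) → N₀ ≤ N →
           Σ (List ℕ) λ ns → Unique ns ×
             All (λ n → (1 ≤ n) × (n ≤ N) × EStarℤ e₁ e₂ e₃ n) ns ×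
             (c ℚ.* c ℚ.* ι (+ N) ℚ.≤ ι (+ (length ns)) ℚ.* ι (+ (length ns))))
lemma4 e₁ e₂ e₃ _ _ _ with ∃-positive-cubic-value e₁ e₂ e₃
... | x , q , p≡P = 1/[1+ q ℕ.+ suc q ] , 1/[1+d]>0 _ , suc q , λ N p≤N →
  let K , pK²≤N , N<p[K+1]² = ∃-square-bracket (suc q) N
  in square-multiples (suc q) K ,
     square-multiples-unique (suc q) K ,
     square-multiples-on-curve e₁ e₂ e₃ x q p≡P N K pK²≤N ,
     square-multiples-length-bound q N K p≤N N<p[K+1]²
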